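{- The partially ordered set $(S_c,\leq)$ is well-founded.
   Context: $S_c$ is the set of all functions $\alpha:\{1,2,\ldots,\omega\}\to\{0,1,\ldots,\omega\}$ for which there is an equivalence relation on a nonempty countable set having exactly $\alpha(m)$ classes of cardinality at least $m$ for each $1\leq m\leq\omega$ ($m=\omega$ meaning infinite classes). It is ordered pointwise: $\alpha\leq\beta\iff\alpha(m)\leq\beta(m)$ for all $m$. -}

module Defs where

open import Level using (Level; 0ℓ)
open import Data.Nat using (ℕ; zero; suc) renaming (_≤_ to _≤ℕ_)
open import Data.Fin using (Fin)
open import Data.Product using (Σ; ∃; _×_; _,_)
open import Data.Empty using (⊥)
open import Relation.Nullary using (¬_)
open import Relation.Binary.PropositionalEquality using (_≡_)
open import Relation.Binary.Structures using (IsEquivalence)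
open import Function.Definitions using (Injective)

-- ℕ ∪ {ω}: finite cardinals together with ω = ℵ₀
data ℕω : Set where
  fin : ℕ → ℕω
  ω   : ℕω

data _≤ω_ : ℕω → ℕω → Set where
  fin≤fin : ∀ {a b} → a ≤ℕ b → fin a ≤ω fin b
  ≤ω-top  : ∀ {x} → x ≤ω ω

-- the index set {1, 2, …, ω}:  idx k  stands for m = k + 1,  idx-ω  for m = ω
data Pos : Set where
  idx   : ℕ → Pos
  idx-ω : Pos

⟦_⟧ : Pos → ℕω
⟦ idx k ⟧ = fin (suc k)
⟦ idx-ω ⟧ = ω

Card : ℕω → Set
Card (fin n) = Fin n
Card ω       = ℕ

ClassAtLeast : {A : Set} (R : A → A → Set) → ℕω → A → Set
ClassAtLeast {A} R κ a =
  Σ (Card κ → A) λ f → Injective _≡_ _≡_ f × (∀ i → R a (f i))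

-- (A, R) has exactly κ classes satisfying the class property P:
-- a family of representatives indexed by a set of size κ, that hits every
-- class with property P exactly once (i.e. a bijection from Card κ onto
-- the set of classes with property P).
ExactlyClasses : {A : Set} (R : A → A → Set) → ℕω → (A → Set) → Set
ExactlyClasses {A} R κ P =
  Σ (Card κ → A) λ g →
      (∀ i → P (g i))
    × (∀ i j → R (g i) (g j) → i ≡ j)
    × (∀ a → P a → ∃ λ i → R a (g i))

Countable : Set → Set
Countable A = Σ (A → ℕ) λ ι → Injective _≡_ _≡_ ι

InSc : (Pos → ℕω) → Set₁
InSc α =
  Σ Set λ A → Countable A × A ×
    Σ (A → A → Set) λ R → IsEquivalence R ×
      (∀ m → ExactlyClasses R (α m) (ClassAtLeast R ⟦ m ⟧))

Sc : Set₁
Sc = Σ (Pos → ℕω) InSc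

_≤Sc_ : Sc → Sc → Set
(α , _) ≤Sc (β , _) = ∀ m → α m ≤ω β m

_<Sc_ : Sc → Sc → Set
x <Sc y = x ≤Sc y × ¬ (y ≤Sc x)

{-# OPTIONS --safe #-}
module Submission where

-- Every α ∈ S_c is antitone on the finite indices, as a class with at least k′ elements has at
-- least k ≤ k′. Along a strictly descending sequence of such maps, a drop at an index k ≥ K starts
-- a tail whose value at k lies below the initial value at K; so by well-founded induction on
-- ℕ ∪ {ω} a counterexample may be assumed never to drop at an index ≥ K. Lowering K one step at a
-- time by the same argument, eventually no finite index drops, and then the ω-index has to drop
-- at every step, which is impossible.

open import Defs
open import Data.Nat using (ℕ)
open import Data.Product using (∃)
open import Relation.Nullary using (¬_)
open import Induction.InfiniteDescent using (InfiniteDescendingSequence)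

open import Data.Nat using (zero; suc; _+_; _≤_; z≤n; s≤s; _≤?_)
open import Data.Nat.Properties using (≤-refl; ≤-trans; ≮⇒≥; m≤n⇒m<n∨m≡n)
open import Data.Fin using (inject≤)
open import Data.Fin.Properties using (injective⇒≤; ℕ→Fin-notInjective; inject≤-injective)
open import Data.Product using (_×_; _,_; proj₁; proj₂)
open import Data.Sum using (inj₁; inj₂)
open import Data.Empty using (⊥-elim)
open import Relation.Nullary using (Dec; yes; no)
open import Relation.Nullary.Decidable using (decidable-stable)
open import Relation.Binary.Core using (Rel)
open import Relation.Binary.PropositionalEquality using (_≡_; refl; subst)
open import Relation.Binary.Structures using (IsEquivalence)
open import Function.Definitions using (Injective)
open import Induction.WellFounded using (Acc; acc; WellFounded)

≤ω-refl : ∀ {x} → x ≤ω x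
≤ω-refl {fin a} = fin≤fin ≤-refl
≤ω-refl {ω}     = ≤ω-top

≤ω-trans : ∀ {x y z} → x ≤ω y → y ≤ω z → x ≤ω z
≤ω-trans (fin≤fin p) (fin≤fin q) = fin≤fin (≤-trans p q)
≤ω-trans _           ≤ω-top      = ≤ω-top

_≤ω?_ : ∀ x y → Dec (x ≤ω y)
fin a ≤ω? fin b with a ≤? b
... | yes a≤b = yes (fin≤fin a≤b)
... | no  a≰b = no λ { (fin≤fin a≤b) → a≰b a≤b }
fin a ≤ω? ω     = yes ≤ω-top
ω     ≤ω? fin b = no λ ()
ω     ≤ω? ω     = yes ≤ω-top

-- Since ≤ω is total, its negation is the strict order.
_<ω_ : Rel ℕω _
x <ω y = ¬ (y ≤ω x)

<ω-≤ω-trans : ∀ {x y z} → x <ω y → y ≤ω z → x <ω z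
<ω-≤ω-trans x<y y≤z z≤x = x<y (≤ω-trans y≤z z≤x)

<ω-suc⇒≤ω : ∀ {x n} → x <ω fin (suc n) → x ≤ω fin n
<ω-suc⇒≤ω {fin a} x<1+n = fin≤fin (≮⇒≥ λ n<a → x<1+n (fin≤fin n<a))
<ω-suc⇒≤ω {ω}     x<1+n = ⊥-elim (x<1+n ≤ω-top)

<fin-accessible : ∀ n {x} → x <ω fin n → Acc _<ω_ x
<fin-accessible zero    {fin a} x<0   = ⊥-elim (x<0 (fin≤fin z≤n))
<fin-accessible zero    {ω}     x<0   = ⊥-elim (x<0 ≤ω-top)
<fin-accessible (suc n)         x<1+n = acc λ y<x → <fin-accessible n (<ω-≤ω-trans y<x (<ω-suc⇒≤ω x<1+n))

<ω-wellFounded : WellFounded _<ω_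
<ω-wellFounded (fin n) = acc (<fin-accessible n)
<ω-wellFounded ω       = acc λ { {fin a} _ → <ω-wellFounded (fin a) ; {ω} ω<ω → ⊥-elim (ω<ω ≤ω-top) }

acc⇒¬descending : ∀ {a r} {A : Set a} {_<_ : Rel A r} {f : ℕ → A} →
                  Acc _<_ (f 0) → ¬ InfiniteDescendingSequence _<_ f
acc⇒¬descending {f = f} (acc rs) desc =
  acc⇒¬descending {f = λ n → f (suc n)} (rs (desc 0)) (λ n → desc (suc n))

_≤ᵖ_ : Rel (Pos → ℕω) _
α ≤ᵖ β = ∀ m → α m ≤ω β m

_<ᵖ_ : Rel (Pos → ℕω) _
α <ᵖ β = α ≤ᵖ β × ¬ (β ≤ᵖ α)

Antitone : (Pos → ℕω) → Set
Antitone α = ∀ {k k′} → k ≤ k′ → α (idx k′) ≤ω α (idx k)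

record DescendingChain (g : ℕ → Pos → ℕω) : Set where
  field
    antitone   : ∀ n → Antitone (g n)
    descending : InfiniteDescendingSequence _<ᵖ_ g

  step : ∀ n → g (suc n) ≤ᵖ g n
  step n = proj₁ (descending n)

  ≤ᵖ-head : ∀ n → g n ≤ᵖ g 0
  ≤ᵖ-head zero    m = ≤ω-refl
  ≤ᵖ-head (suc n) m = ≤ω-trans (step n m) (≤ᵖ-head n m)

  drop<head : ∀ {n K k} → K ≤ k → g (suc n) (idx k) <ω g n (idx k) →
              g (suc n) (idx k) <ω g 0 (idx K)
  drop<head {n} K≤k drop = <ω-≤ω-trans drop (≤ω-trans (antitone n K≤k) (≤ᵖ-head n (idx _)))

open DescendingChain

shift : ℕ → (ℕ → Pos → ℕω) → ℕ → Pos → ℕω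
shift j g n = g (n + j)

shift-chain : ∀ {g} j → DescendingChain g → DescendingChain (shift j g)
shift-chain j ch = record
  { antitone   = λ n → antitone ch (n + j)
  ; descending = λ n → descending ch (n + j)
  }

StableAt : ℕ → (ℕ → Pos → ℕω) → Set
StableAt k g = ∀ n → g n (idx k) ≤ω g (suc n) (idx k)

StableFrom : ℕ → (ℕ → Pos → ℕω) → Set
StableFrom K g = ∀ k → K ≤ k → StableAt k g

stableFrom-suc : ∀ {K g} → StableAt K g → StableFrom (suc K) g → StableFrom K g
stableFrom-suc stK stSK k K≤k with m≤n⇒m<n∨m≡n K≤k
... | inj₁ K<k  = stSK k K<k
... | inj₂ refl = stK

stableFrom-shift : ∀ {K g} j → StableFrom K g → StableFrom K (shift j g)
stableFrom-shift j st k K≤k n = st k K≤k (n + j)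

¬stableFrom : ∀ {g} K → DescendingChain g → ¬ StableFrom K g
¬stableFrom {g} zero ch st = acc⇒¬descending (<ω-wellFounded _) ω-drops
  where
  ω-drops : InfiniteDescendingSequence _<ω_ (λ n → g n idx-ω)
  ω-drops n ω-stable = proj₂ (descending ch n) λ { (idx k) → st k z≤n n ; idx-ω → ω-stable }
¬stableFrom (suc K) ch st = go (<ω-wellFounded _) ch st
  where
  go : ∀ {g} → Acc _<ω_ (g 0 (idx K)) → DescendingChain g → ¬ StableFrom (suc K) g
  go {g} (acc rs) ch st = ¬stableFrom K ch (stableFrom-suc {g = g} stK st)
    where
    stK : StableAt K g
    stK n = decidable-stable (_ ≤ω? _) λ drop →
      go {shift (suc n) g} (rs (drop<head ch ≤-refl drop))
         (shift-chain (suc n) ch) (stableFrom-shift {g = g} (suc n) st)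

¬descendingChain : ∀ {g} → ¬ DescendingChain g
¬descendingChain ch = go {K = 0} (<ω-wellFounded _) ch
  where
  go : ∀ {g K} → Acc _<ω_ (g 0 (idx K)) → ¬ DescendingChain g
  go {g} {K} (acc rs) ch = ¬stableFrom K ch λ k K≤k n → decidable-stable (_ ≤ω? _) λ drop →
    go {shift (suc n) g} (rs (drop<head ch K≤k drop)) (shift-chain (suc n) ch)

Card-injective⇒≤ω : ∀ a b {h : Card b → Card a} → Injective _≡_ _≡_ h → b ≤ω a
Card-injective⇒≤ω ω       _                 inj = ≤ω-top
Card-injective⇒≤ω (fin n) (fin m)           inj = fin≤fin (injective⇒≤ inj)
Card-injective⇒≤ω (fin n) ω       {h = h}   inj = ⊥-elim (ℕ→Fin-notInjective h inj)

exactlyClasses-mono : ∀ {A : Set} {R : Rel A _} → IsEquivalence R → ∀ {a b P Q} →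
                      (∀ x → Q x → P x) → ExactlyClasses R b Q → ExactlyClasses R a P → b ≤ω a
exactlyClasses-mono {R = R} isEq {a} {b} Q⊆P (gQ , Q-gQ , gQ-distinct , _) (gP , _ , _ , gP-covers) =
  Card-injective⇒≤ω a b classIndex-injective
  where
  open IsEquivalence isEq
  classIndex : Card b → Card a
  classIndex i = proj₁ (gP-covers (gQ i) (Q⊆P _ (Q-gQ i)))
  inClass : ∀ i → R (gQ i) (gP (classIndex i))
  inClass i = proj₂ (gP-covers (gQ i) (Q⊆P _ (Q-gQ i)))
  classIndex-injective : Injective _≡_ _≡_ classIndex
  classIndex-injective {i} {j} eq =
    gQ-distinct i j (trans (subst (λ c → R (gQ i) (gP c)) eq (inClass i)) (sym (inClass j)))

classAtLeast-weaken : ∀ {A : Set} (R : Rel A _) {k k′} → k ≤ k′ → ∀ {x} →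
                      ClassAtLeast R (fin k′) x → ClassAtLeast R (fin k) x
classAtLeast-weaken R k≤k′ (f , f-injective , inClass) =
  (λ i → f (inject≤ i k≤k′)) ,
  (λ eq → inject≤-injective k≤k′ k≤k′ _ _ (f-injective eq)) ,
  (λ i → inClass _)

InSc⇒antitone : ∀ {α} → InSc α → Antitone α
InSc⇒antitone (_ , _ , _ , R , isEq , exactly) k≤k′ =
  exactlyClasses-mono isEq (λ x → classAtLeast-weaken R (s≤s k≤k′)) (exactly (idx _)) (exactly (idx _))

lemma5p2 : ¬ (∃ λ (f : ℕ → Sc) → InfiniteDescendingSequence _<Sc_ f)
lemma5p2 (f , desc) = ¬descendingChain {λ n → proj₁ (f n)} record
  { antitone   = λ n → InSc⇒antitone (proj₂ (f n))
  ; descending = desc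
  }
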